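{- If $\mathbf{A}$ is a nontrivial (at least two-element) finite lattice and $C=\mathrm{Clo}(\mathbf{A})$, then the relational structure $(A;C^{\bullet})$ is not polymorphism-homogeneous.
   Context: The graph of an $n$-ary operation $f$ is $f^\bullet=\{(a_1,\dots,a_{n+1})\in A^{n+1}: f(a_1,\dots,a_n)=a_{n+1}\}$, and $C^\bullet=\{f^\bullet: f\in C\}$. A partial $k$-ary operation $h$ (domain $\mathrm{dom}\,h\subseteq A^k$) preserves $\rho\subseteq A^n$ if for every $n\times k$ matrix whose columns lie in $\rho$ and rows $r_1,\dots,r_n$ lie in $\mathrm{dom}\,h$, $(h(r_1),\dots,h(r_n))\in\rho$. A relational structure $(A;R)$ is polymorphism-homogeneous if for every $k\ge1$ every partial $k$-ary operation preserving all of $R$ extends to a total $k$-ary operation preserving all of $R$. -}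

module Defs where

open import Data.Nat using (ℕ; suc; _≤_)
open import Data.Fin using (Fin; inject₁; fromℕ)
open import Data.Maybe using (Maybe; just)
open import Data.Product using (Σ; ∃; _×_)
open import Relation.Binary.PropositionalEquality using (_≡_)
open import Relation.Nullary using (¬_)
open import Level using (0ℓ)


Rel : Set → ℕ → Set₁
Rel A n = (Fin n → A) → Set

Op : Set → ℕ → Set
Op A k = (Fin k → A) → A

POp : Set → ℕ → Set
POp A k = (Fin k → A) → Maybe A

record RelStructure (A : Set) : Set₁ where
  field
    Index : Set
    arity : Index → ℕ
    rel   : (i : Index) → Rel A (arity i)

-- partial operation h preserves ρ: for every n×k matrix M (rows M r ∈ A^k,
-- columns λ r → M r j ∈ A^n) whose columns lie in ρ and whose rows lie in
-- dom h with values b r, the tuple (b r)_r lies in ρ.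
PPreserves : {A : Set} {k n : ℕ} → POp A k → Rel A n → Set
PPreserves {A} {k} {n} h ρ =
  (M : Fin n → Fin k → A) (b : Fin n → A) →
  (∀ j → ρ (λ r → M r j)) →
  (∀ r → h (M r) ≡ just (b r)) →
  ρ b

Preserves : {A : Set} {k n : ℕ} → Op A k → Rel A n → Set
Preserves {A} {k} {n} g ρ =
  (M : Fin n → Fin k → A) → (∀ j → ρ (λ r → M r j)) → ρ (λ r → g (M r))

Extends : {A : Set} {k : ℕ} → Op A k → POp A k → Set
Extends {A} {k} g h = ∀ x a → h x ≡ just a → g x ≡ a

PolymorphismHomogeneous : {A : Set} → RelStructure A → Set
PolymorphismHomogeneous {A} S =
  (k : ℕ) → 1 ≤ k → (h : POp A k) →
  (∀ i → PPreserves h (rel i)) →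
  Σ (Op A k) λ g → Extends g h × (∀ i → Preserves g (rel i))
  where open RelStructure S

graph : {A : Set} {n : ℕ} → Op A n → Rel A (suc n)
graph {A} {n} f a = f (λ i → a (inject₁ i)) ≡ a (fromℕ n)

data Term (k : ℕ) : Set where
  var  : Fin k → Term k
  _⊔ₜ_ : Term k → Term k → Term k
  _⊓ₜ_ : Term k → Term k → Term k

eval : {A : Set} (_∨_ _∧_ : A → A → A) {k : ℕ} → Term k → Op A k
eval _∨_ _∧_ (var i)  x = x i
eval _∨_ _∧_ (s ⊔ₜ t) x = eval _∨_ _∧_ s x ∨ eval _∨_ _∧_ t x
eval _∨_ _∧_ (s ⊓ₜ t) x = eval _∨_ _∧_ s x ∧ eval _∨_ _∧_ t x

InClo : {A : Set} (_∨_ _∧_ : A → A → A) (n : ℕ) → Op A n → Set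
InClo {A} _∨_ _∧_ n f = ∃ λ (t : Term n) → ∀ x → f x ≡ eval _∨_ _∧_ t x

CloGraphStructure : {A : Set} (_∨_ _∧_ : A → A → A) → RelStructure A
CloGraphStructure {A} _∨_ _∧_ = record
  { Index = Σ ℕ λ n → Σ (Op A n) (InClo _∨_ _∧_ n)
  ; arity = λ i → suc (Data.Product.proj₁ i)
  ; rel   = λ i → graph (Data.Product.proj₁ (Data.Product.proj₂ i))
  }

module Submission where

-- Finiteness is only used through decidable
-- equality, so the argument is carried out for any lattice with decidable
-- equality, ordered by x ≼ y ⇔ x = x ∧ y.
--
-- The witness is the 4-ary partial "gap" operation, defined at x exactly when
-- x₀ ∨ x₁ = x₂ ∧ x₃ and then taking this common value.
--
--  * Every term operation is monotone, and gap preserves the graph of every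
--    monotone operation: on rows in dom gap the values are squeezed between
--    f(column 0) ∨ f(column 1) and f(column 2) ∧ f(column 3).
--  * A total extension g of gap preserving the graphs of ∨ and ∧ commutes
--    with both.  For a ≼ b evaluate g at c = (a,a,b,b) = p ∨ q = r ∧ s with
--    p = (a,a,a,b), q = (a,a,b,a), r = (a,b,b,b), s = (b,a,b,b), all in dom gap:
--    then a = g p ∨ g q = g c = g r ∧ g s = b.
--  * With x ≠ y take a = x ∧ y ≼ x ∨ y = b; a = b would force x = y.

open import Defs
open import Level using (0ℓ)
open import Data.Nat using (ℕ; _≤_; suc; s≤s; z≤n)
open import Data.Fin using (Fin; zero; suc; #_; inject₁; fromℕ)
open import Data.Fin.Properties using () renaming (_≟_ to _≟ᶠ_)
open import Data.Maybe using (just; nothing)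
open import Data.Product using (_,_)
open import Data.Vec.Functional using ([]; _∷_)
open import Function using (_∘_)
open import Relation.Binary.Definitions using (DecidableEquality)
open import Relation.Binary.PropositionalEquality
  using (_≡_; _≢_; refl; sym; trans; cong; cong₂; subst₂; module ≡-Reasoning)
open import Relation.Nullary using (¬_; yes; no; contradiction)
open import Algebra.Lattice.Structures using (IsLattice)
open import Algebra.Lattice.Bundles using (Lattice)
import Algebra.Lattice.Properties.Lattice as AlgebraicLatticeProperties
import Relation.Binary.Lattice as OrderLattice
import Relation.Binary.Lattice.Properties.JoinSemilattice as JoinProperties
import Relation.Binary.Lattice.Properties.MeetSemilattice as MeetProperties

module _ {A : Set} (_∨_ _∧_ : A → A → A) (isLattice : IsLattice _≡_ _∨_ _∧_) where

  open IsLattice isLattice using (∨-comm; ∧-comm)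

  lattice : Lattice 0ℓ 0ℓ
  lattice = record { Carrier = A ; _≈_ = _≡_ ; _∨_ = _∨_ ; _∧_ = _∧_ ; isLattice = isLattice }

  open AlgebraicLatticeProperties lattice using (∨-∧-orderTheoreticLattice; ∧-idem; ∨-idem)
  open OrderLattice.Lattice ∨-∧-orderTheoreticLattice
    using (antisym; ≤-respˡ-≈; ≤-respʳ-≈; x≤x∨y; y≤x∨y; ∨-least;
           x∧y≤x; x∧y≤y; ∧-greatest; joinSemilattice; meetSemilattice)
    renaming (_≤_ to _≼_; trans to ≼-trans)
  open JoinProperties joinSemilattice using (∨-monotonic; x≤y⇒x∨y≈y)
  open MeetProperties meetSemilattice using (∧-monotonic; y≤x⇒x∧y≈y)

  Monotone : {k : ℕ} → Op A k → Set
  Monotone {k} f = ∀ {u v : Fin k → A} → (∀ i → u i ≼ v i) → f u ≼ f v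

  term-monotone : {k : ℕ} (t : Term k) → Monotone (eval _∨_ _∧_ t)
  term-monotone (var i)  u≼v = u≼v i
  term-monotone (s ⊔ₜ t) u≼v = ∨-monotonic (term-monotone s u≼v) (term-monotone t u≼v)
  term-monotone (s ⊓ₜ t) u≼v = ∧-monotonic (term-monotone s u≼v) (term-monotone t u≼v)

  clone-monotone : {n : ℕ} {f : Op A n} → InClo _∨_ _∧_ n f → Monotone f
  clone-monotone (t , f≗t) {u} {v} u≼v =
    subst₂ _≼_ (sym (f≗t u)) (sym (f≗t v)) (term-monotone t u≼v)

  ∧≡∨⇒≡ : ∀ {x y} → x ∧ y ≡ x ∨ y → x ≡ y
  ∧≡∨⇒≡ {x} {y} x∧y≡x∨y = antisym
    (≼-trans (≤-respʳ-≈ (sym x∧y≡x∨y) (x≤x∨y x y)) (x∧y≤y x y))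
    (≼-trans (≤-respʳ-≈ (sym x∧y≡x∨y) (y≤x∨y x y)) (x∧y≤x x y))

  binary : (A → A → A) → Op A 2
  binary _∙_ x = x (# 0) ∙ x (# 1)

  -- A total operation preserving the graph of ∙ commutes with ∙:
  -- it maps the rows p, q, p ∙ q of a 3-row matrix to g p, g q, g p ∙ g q.
  preserves-binary : ∀ {k} (_∙_ : A → A → A) (g : Op A k) →
    Preserves g (graph (binary _∙_)) →
    ∀ {p q c : Fin k → A} → (∀ j → p j ∙ q j ≡ c j) → g p ∙ g q ≡ g c
  preserves-binary _∙_ g pres {p} {q} {c} pq≡c = pres (p ∷ q ∷ c ∷ []) pq≡c

  module _ (_≟_ : DecidableEquality A) where

    gap : POp A 4
    gap x with (x (# 0) ∨ x (# 1)) ≟ (x (# 2) ∧ x (# 3))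
    ... | yes _ = just (x (# 0) ∨ x (# 1))
    ... | no _  = nothing

    gap-join : ∀ {x c} → gap x ≡ just c → x (# 0) ∨ x (# 1) ≡ c
    gap-join {x} gx≡c with (x (# 0) ∨ x (# 1)) ≟ (x (# 2) ∧ x (# 3))
    gap-join refl | yes _ = refl

    gap-meet : ∀ {x c} → gap x ≡ just c → x (# 2) ∧ x (# 3) ≡ c
    gap-meet {x} gx≡c with (x (# 0) ∨ x (# 1)) ≟ (x (# 2) ∧ x (# 3))
    gap-meet refl | yes join≡meet = sym join≡meet

    gap-defined : ∀ {x c} → x (# 0) ∨ x (# 1) ≡ c → x (# 2) ∧ x (# 3) ≡ c → gap x ≡ just c
    gap-defined {x} join≡c meet≡c with (x (# 0) ∨ x (# 1)) ≟ (x (# 2) ∧ x (# 3))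
    ... | yes _         = cong just join≡c
    ... | no join≢meet  = contradiction (trans join≡c (sym meet≡c)) join≢meet

    -- gap preserves the graph of every monotone operation f: for rows r in
    -- dom gap with values b r, the last value b l is bounded above by
    -- f(column 2) ∧ f(column 3) and below by f(column 0) ∨ f(column 1),
    -- both of which are squeezed onto f applied to the other values.
    gap-preserves-monotone : ∀ {n} {f : Op A n} → Monotone f → PPreserves gap (graph f)
    gap-preserves-monotone {n} {f} mono M b columns∈f rows∈gap = antisym upper lower
      where
        l : Fin (suc n)
        l = fromℕ n

        column : Fin 4 → Fin n → A
        column j i = M (inject₁ i) j

        B : Fin n → A
        B = b ∘ inject₁

        B≽column₀ : ∀ i → column (# 0) i ≼ B i
        B≽column₀ i = ≤-respʳ-≈ (gap-join (rows∈gap (inject₁ i))) (x≤x∨y _ _)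

        B≽column₁ : ∀ i → column (# 1) i ≼ B i
        B≽column₁ i = ≤-respʳ-≈ (gap-join (rows∈gap (inject₁ i))) (y≤x∨y _ _)

        B≼column₂ : ∀ i → B i ≼ column (# 2) i
        B≼column₂ i = ≤-respˡ-≈ (gap-meet (rows∈gap (inject₁ i))) (x∧y≤x _ _)

        B≼column₃ : ∀ i → B i ≼ column (# 3) i
        B≼column₃ i = ≤-respˡ-≈ (gap-meet (rows∈gap (inject₁ i))) (x∧y≤y _ _)

        upper : f B ≼ b l
        upper = ≤-respʳ-≈ (gap-meet (rows∈gap l))
          (∧-greatest (≤-respʳ-≈ (columns∈f (# 2)) (mono B≼column₂))
                      (≤-respʳ-≈ (columns∈f (# 3)) (mono B≼column₃)))

        lower : b l ≼ f B
        lower = ≤-respˡ-≈ (gap-join (rows∈gap l))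
          (∨-least (≤-respˡ-≈ (columns∈f (# 0)) (mono B≽column₀))
                   (≤-respˡ-≈ (columns∈f (# 1)) (mono B≽column₁)))

    gap-preserves-clone : ∀ i → PPreserves gap (RelStructure.rel (CloGraphStructure _∨_ _∧_) i)
    gap-preserves-clone (n , f , f∈C) = gap-preserves-monotone (clone-monotone f∈C)

    extension-collapses : (g : Op A 4) → Extends g gap →
      Preserves g (graph (binary _∨_)) → Preserves g (graph (binary _∧_)) →
      ∀ {a b} → a ≼ b → a ≡ b
    extension-collapses g extends pres∨ pres∧ {a} {b} a≼b = begin
      a         ≡⟨ sym (∨-idem a) ⟩
      a ∨ a     ≡⟨ cong₂ _∨_ (sym gp≡a) (sym gq≡a) ⟩
      g p ∨ g q ≡⟨ preserves-binary _∨_ g pres∨ p∨q≡c ⟩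
      g c       ≡⟨ sym (preserves-binary _∧_ g pres∧ r∧s≡c) ⟩
      g r ∧ g s ≡⟨ cong₂ _∧_ gr≡b gs≡b ⟩
      b ∧ b     ≡⟨ ∧-idem b ⟩
      b         ∎
      where
        open ≡-Reasoning

        a∨b≡b : a ∨ b ≡ b
        a∨b≡b = x≤y⇒x∨y≈y a≼b
        b∨a≡b : b ∨ a ≡ b
        b∨a≡b = trans (∨-comm b a) a∨b≡b
        b∧a≡a : b ∧ a ≡ a
        b∧a≡a = y≤x⇒x∧y≈y a≼b
        a∧b≡a : a ∧ b ≡ a
        a∧b≡a = trans (∧-comm a b) b∧a≡a

        p q r s c : Fin 4 → A
        p = a ∷ a ∷ a ∷ b ∷ []
        q = a ∷ a ∷ b ∷ a ∷ []
        r = a ∷ b ∷ b ∷ b ∷ []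
        s = b ∷ a ∷ b ∷ b ∷ []
        c = a ∷ a ∷ b ∷ b ∷ []

        value : ∀ {x v} → x (# 0) ∨ x (# 1) ≡ v → x (# 2) ∧ x (# 3) ≡ v → g x ≡ v
        value {x} {v} join≡v meet≡v = extends x v (gap-defined join≡v meet≡v)

        gp≡a : g p ≡ a
        gp≡a = value (∨-idem a) a∧b≡a
        gq≡a : g q ≡ a
        gq≡a = value (∨-idem a) b∧a≡a
        gr≡b : g r ≡ b
        gr≡b = value a∨b≡b (∧-idem b)
        gs≡b : g s ≡ b
        gs≡b = value b∨a≡b (∧-idem b)

        p∨q≡c : ∀ j → p j ∨ q j ≡ c j
        p∨q≡c zero                   = ∨-idem a
        p∨q≡c (suc zero)             = ∨-idem a
        p∨q≡c (suc (suc zero))       = a∨b≡b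
        p∨q≡c (suc (suc (suc zero))) = b∨a≡b

        r∧s≡c : ∀ j → r j ∧ s j ≡ c j
        r∧s≡c zero                   = a∧b≡a
        r∧s≡c (suc zero)             = b∧a≡a
        r∧s≡c (suc (suc zero))       = ∧-idem b
        r∧s≡c (suc (suc (suc zero))) = ∧-idem b

    join-index meet-index : RelStructure.Index (CloGraphStructure _∨_ _∧_)
    join-index = 2 , binary _∨_ , var (# 0) ⊔ₜ var (# 1) , λ _ → refl
    meet-index = 2 , binary _∧_ , var (# 0) ⊓ₜ var (# 1) , λ _ → refl

    not-homogeneous : ∀ {x y} → x ≢ y → ¬ PolymorphismHomogeneous (CloGraphStructure _∨_ _∧_)
    not-homogeneous {x} {y} x≢y homogeneous with homogeneous 4 (s≤s z≤n) gap gap-preserves-clone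
    ... | g , extends , preserves = x≢y (∧≡∨⇒≡ (extension-collapses g extends
            (preserves join-index) (preserves meet-index) (≼-trans (x∧y≤x x y) (x≤x∨y x y))))

theorem4p6 : (m : ℕ) → 2 ≤ m → (_∨_ _∧_ : Fin m → Fin m → Fin m) →
    IsLattice {A = Fin m} _≡_ _∨_ _∧_ →
    ¬ PolymorphismHomogeneous (CloGraphStructure _∨_ _∧_)
theorem4p6 (suc (suc m)) (s≤s (s≤s z≤n)) _∨_ _∧_ isLattice =
  not-homogeneous _∨_ _∧_ isLattice _≟ᶠ_ {zero} {suc zero} λ ()
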